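{- Let $h\ge 3$ be an integer and let $A=\{a+id:i=0,1,\ldots,h\}$ be an $(h+1)$-term arithmetic progression of positive integers with common difference $d>0$. Then $$\left|h^{\wedge}_{\pm}A\right|\ge\begin{cases}(h+1)^2,& \text{if } d=2\min(A),\\ (h+1)^2+1,&\text{otherwise.}\end{cases}$$ Furthermore, $\left|h^{\wedge}_{\pm}A\right|=(h+1)^2$ if and only if $d=2\min(A)$.
   Context: For a positive integer $h$ and a finite set of integers $A=\{a_1,\ldots,a_k\}$ (distinct elements), the restricted $h$-fold signed sumset is $h^{\wedge}_{\pm}A=\left\{\sum_{i=1}^k\lambda_i a_i:\lambda_i\in\{ -1,0,1\},\ \sum_{i=1}^k|\lambda_i|=h\right\}$. -}

module Defs where

open import Data.Nat as ℕ using (ℕ; zero; suc)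
open import Data.Integer as ℤ using (ℤ; +_)
open import Data.Fin using (Fin)
import Data.Fin as Fin
open import Data.Product using (Σ; ∃; _×_)
open import Data.List using (List; length)
open import Data.List.Membership.Propositional using (_∈_)
open import Data.List.Relation.Unary.Unique.Propositional using (Unique)
open import Function.Bundles using (_⇔_)
open import Relation.Binary.PropositionalEquality using (_≡_)

data Sign : Set where
  neg zer pos : Sign

val : Sign → ℤ
val neg = ℤ.-[1+ 0 ]
val zer = + 0
val pos = + 1

absS : Sign → ℕ
absS zer = 0
absS neg = 1
absS pos = 1

sumℕ : {k : ℕ} → (Fin k → ℕ) → ℕ
sumℕ {zero}  f = 0
sumℕ {suc k} f = f Fin.zero ℕ.+ sumℕ (λ i → f (Fin.suc i))

sumℤ : {k : ℕ} → (Fin k → ℤ) → ℤ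
sumℤ {zero}  f = + 0
sumℤ {suc k} f = f Fin.zero ℤ.+ sumℤ (λ i → f (Fin.suc i))

-- x ∈ h^∧_± A, where A = {a_1,…,a_k} is given by the (injective) enumeration a : Fin k → ℤ
InSignedSumset : (h k : ℕ) → (Fin k → ℤ) → ℤ → Set
InSignedSumset h k a x =
  Σ (Fin k → Sign) λ lam →
    (sumℕ (λ i → absS (lam i)) ≡ h) × (sumℤ (λ i → val (lam i) ℤ.* a i) ≡ x)

HasCard : (ℤ → Set) → ℕ → Set
HasCard P n = Σ (List ℤ) λ xs → Unique xs × (length xs ≡ n) × (∀ x → (x ∈ xs) ⇔ P x)

AP : (a d h : ℕ) → Fin (suc h) → ℤ
AP a d h i = + (a ℕ.+ Fin.toℕ i ℕ.* d)

-- Replace every coefficient λᵢ by its weight λᵢ + 1 ∈ {0, 1, 2}. A choice of h nonzero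
-- coefficients out of h + 1 has exactly one zero; if p of them are +1, then after translating
-- by Σ A its signed sum becomes a(2p + 1) + d m, where m = Σᵢ (λᵢ + 1) i is the moment of the
-- weights. Appending a coefficient −1 or +1 at the end shows, by induction on h from a
-- machine-checked base case h = 3, that every pair (p, m) with p < h and p² ≤ m ≤ (p + 1)²,
-- or p = h and h² ≤ m ≤ h² + h, occurs. In lexicographic order these (h + 1)² pairs have
-- strictly increasing values, so the sumset has at least (h + 1)² elements. The pair
-- (h − 1, h² + 1) occurs as well, and its value coincides with one of those only if d = 2a.
-- Conversely, for d = 2a every value is a(2(p + m) + 1) with p + m < (h + 1)².
module Submission where

open import Defs
open import Data.Nat using (ℕ; suc; _+_; _*_; _≤_; _≥_; _<_)
open import Data.Product using (Σ; _×_)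
open import Relation.Nullary using (¬_)
open import Relation.Binary.PropositionalEquality using (_≡_)
open import Function.Bundles using (_⇔_)

import Data.Integer.Properties as ℤₚ
open import Algebra.Properties.AbelianGroup ℤₚ.+-0-abelianGroup using (∙-cancelʳ)
open import Data.Empty using (⊥-elim)
open import Data.Fin as Fin using (Fin; toℕ)
open import Data.Integer as ℤ using (ℤ; +_)
open import Data.List as List
  using (List; []; _∷_; [_]; length; map; filter; deduplicate; cartesianProductWith; applyUpTo)
open import Data.List.Membership.Propositional using (_∈_; _─_; lose)
open import Data.List.Membership.Propositional.Properties
import Data.List.Properties as Listₚ
open import Data.List.Relation.Binary.Subset.Propositional using (_⊆_)
open import Data.List.Relation.Unary.All as All using (All)
import Data.List.Relation.Unary.All.Properties as Allₚ
open import Data.List.Relation.Unary.AllPairs using (_∷_)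
open import Data.List.Relation.Unary.Any using (here; there; index; any?; satisfied)
open import Data.List.Relation.Unary.Unique.Propositional using (Unique)
import Data.List.Relation.Unary.Unique.Propositional.Properties as Uniqueₚ
open import Data.List.Relation.Unary.Unique.DecPropositional.Properties ℤ._≟_ using (deduplicate-!)
open import Data.Nat as ℕ using (zero; z≤n; s≤s; s≤s⁻¹; _≟_; _<?_; _≤?_)
import Data.Nat.Properties as ℕₚ
import Algebra.Properties.CommutativeSemigroup as CommutativeSemigroupₚ
open import Data.Nat.Tactic.RingSolver using (solve-∀)
open import Data.Product using (_,_; proj₁; proj₂)
open import Data.Sum using (_⊎_; inj₁; inj₂)
open import Data.Vec as Vec using (Vec; []; _∷_; _∷ʳ_; lookup; tabulate; replicate)
open import Data.Vec.Properties using (lookup∘tabulate)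
open import Function using (_∘_)
open import Function.Bundles using (Equivalence; mk⇔)
import Function.Properties.Equivalence as ⇔
open import Relation.Binary.PropositionalEquality
  using (_≢_; refl; sym; trans; cong; cong₂; subst; subst₂; module ≡-Reasoning)
open import Relation.Nullary using (Dec; yes; no)
open import Relation.Nullary.Decidable using (_×-dec_; _⊎-dec_; _→-dec_; from-yes; map′; decidable-stable)
open import Relation.Nullary.Negation using (contradiction)

module ℤ+ = CommutativeSemigroupₚ ℤₚ.+-commutativeSemigroup
module ℕ+ = CommutativeSemigroupₚ ℕₚ.+-commutativeSemigroup

∈-─ : ∀ {A : Set} {x y : A} {xs} (x∈xs : x ∈ xs) → y ∈ xs → y ≢ x → y ∈ xs ─ x∈xs
∈-─ (here refl)  (here refl)  y≢x = ⊥-elim (y≢x refl)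
∈-─ (here refl)  (there y∈xs) y≢x = y∈xs
∈-─ (there x∈xs) (here refl)  y≢x = here refl
∈-─ (there x∈xs) (there y∈xs) y≢x = there (∈-─ x∈xs y∈xs y≢x)

unique-⊆⇒length≤ : ∀ {A : Set} {ys xs : List A} → Unique ys → ys ⊆ xs → length ys ≤ length xs
unique-⊆⇒length≤ {ys = []} _ _ = z≤n
unique-⊆⇒length≤ {ys = y ∷ ys} {xs} (y∉ys ∷ ys!) ys⊆xs =
  subst (suc (length ys) ≤_) (sym (Listₚ.length-removeAt′ xs (index y∈xs)))
    (s≤s (unique-⊆⇒length≤ ys! (λ z∈ys → ∈-─ y∈xs (ys⊆xs (there z∈ys)) (z≢y z∈ys))))
  where
  y∈xs = ys⊆xs (here refl)
  z≢y : ∀ {z} → z ∈ ys → z ≢ y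
  z≢y z∈ys z≡y = All.lookup y∉ys z∈ys (sym z≡y)

weight : Sign → ℕ
weight neg = 0
weight zer = 1
weight pos = 2

isPos : Sign → ℕ
isPos neg = 0
isPos zer = 0
isPos pos = 1

total : (Sign → ℕ) → ∀ {n} → Vec Sign n → ℕ
total f []      = 0
total f (s ∷ v) = f s + total f v

moment : ℕ → ∀ {n} → Vec Sign n → ℕ
moment c []      = 0
moment c (s ∷ v) = weight s * c + moment (suc c) v

sumℕ-cong : ∀ {k} {f g : Fin k → ℕ} → (∀ i → f i ≡ g i) → sumℕ f ≡ sumℕ g
sumℕ-cong {zero}  f≗g = refl
sumℕ-cong {suc k} f≗g = cong₂ _+_ (f≗g Fin.zero) (sumℕ-cong (f≗g ∘ Fin.suc))

sumℤ-cong : ∀ {k} {f g : Fin k → ℤ} → (∀ i → f i ≡ g i) → sumℤ f ≡ sumℤ g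
sumℤ-cong {zero}  f≗g = refl
sumℤ-cong {suc k} f≗g = cong₂ ℤ._+_ (f≗g Fin.zero) (sumℤ-cong (f≗g ∘ Fin.suc))

sumℕ-lookup : ∀ (f : Sign → ℕ) {n} (v : Vec Sign n) → sumℕ (f ∘ lookup v) ≡ total f v
sumℕ-lookup f []      = refl
sumℕ-lookup f (s ∷ v) = cong (λ t → f s + t) (sumℕ-lookup f v)

val*+weight : ∀ s b → val s ℤ.* + b ℤ.+ + b ≡ + (weight s * b)
val*+weight neg b = trans (cong (ℤ._+ + b) (ℤₚ.-1*i≡-i (+ b))) (ℤₚ.+-inverseˡ (+ b))
val*+weight zer b = trans (cong (ℤ._+ + b) (ℤₚ.*-zeroˡ (+ b))) (cong +_ (sym (ℕₚ.+-identityʳ b)))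
val*+weight pos b =
  trans (cong (ℤ._+ + b) (ℤₚ.*-identityˡ (+ b))) (cong (λ t → + (b + t)) (sym (ℕₚ.+-identityʳ b)))

signedSum+sum : ∀ {n} (σ : Fin n → Sign) (b : Fin n → ℕ) →
  sumℤ (λ i → val (σ i) ℤ.* + b i) ℤ.+ + sumℕ b ≡ + sumℕ (λ i → weight (σ i) * b i)
signedSum+sum {zero}  σ b = refl
signedSum+sum {suc n} σ b = trans (ℤ+.interchange x X (+ b₀) (+ sumℕ (b ∘ Fin.suc)))
  (cong₂ ℤ._+_ (val*+weight (σ Fin.zero) b₀) (signedSum+sum (σ ∘ Fin.suc) (b ∘ Fin.suc)))
  where
  b₀ = b Fin.zero
  x = val (σ Fin.zero) ℤ.* + b₀
  X = sumℤ (λ i → val (σ (Fin.suc i)) ℤ.* + b (Fin.suc i))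

weightedSum-AP : ∀ (a d : ℕ) {n} (v : Vec Sign n) c →
  sumℕ (λ i → weight (lookup v i) * (a + (c + toℕ i) * d)) ≡ a * total weight v + d * moment c v
weightedSum-AP a d []      c = sym (cong₂ _+_ (ℕₚ.*-zeroʳ a) (ℕₚ.*-zeroʳ d))
weightedSum-AP a d (s ∷ v) c = begin
    weight s * (a + (c + 0) * d) + sumℕ (λ i → weight (lookup v i) * (a + (c + suc (toℕ i)) * d))
  ≡⟨ cong₂ (λ x y → weight s * (a + x * d) + y) (ℕₚ.+-identityʳ c)
       (sumℕ-cong (λ i → cong (λ x → weight (lookup v i) * (a + x * d)) (ℕₚ.+-suc c (toℕ i)))) ⟩
    weight s * (a + c * d) + sumℕ (λ i → weight (lookup v i) * (a + (suc c + toℕ i) * d))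
  ≡⟨ cong (λ t → weight s * (a + c * d) + t) (weightedSum-AP a d v (suc c)) ⟩
    weight s * (a + c * d) + (a * total weight v + d * moment (suc c) v)
  ≡⟨ regroup (weight s) a c d (total weight v) (moment (suc c) v) ⟩
    a * (weight s + total weight v) + d * (weight s * c + moment (suc c) v)
  ∎
  where
  open ≡-Reasoning
  regroup : ∀ w a c d T M → w * (a + c * d) + (a * T + d * M) ≡ a * (w + T) + d * (w * c + M)
  regroup = solve-∀

total-∷ʳ : ∀ f {n} (v : Vec Sign n) s → total f (v ∷ʳ s) ≡ total f v + f s
total-∷ʳ f []      s = ℕₚ.+-identityʳ (f s)
total-∷ʳ f (x ∷ v) s = trans (cong (λ t → f x + t) (total-∷ʳ f v s)) (sym (ℕₚ.+-assoc (f x) _ _))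

moment-∷ʳ : ∀ c {n} (v : Vec Sign n) s → moment c (v ∷ʳ s) ≡ moment c v + weight s * (c + n)
moment-∷ʳ c []          s = trans (ℕₚ.+-identityʳ _) (cong (weight s *_) (sym (ℕₚ.+-identityʳ c)))
moment-∷ʳ c {suc n} (x ∷ v) s = begin
    weight x * c + moment (suc c) (v ∷ʳ s)
  ≡⟨ cong (λ t → weight x * c + t) (moment-∷ʳ (suc c) v s) ⟩
    weight x * c + (moment (suc c) v + weight s * (suc c + n))
  ≡⟨ sym (ℕₚ.+-assoc (weight x * c) _ _) ⟩
    weight x * c + moment (suc c) v + weight s * (suc c + n)
  ≡⟨ cong (λ t → weight x * c + moment (suc c) v + weight s * t) (sym (ℕₚ.+-suc c n)) ⟩
    weight x * c + moment (suc c) v + weight s * (c + suc n)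
  ∎
  where open ≡-Reasoning

total-replicate : ∀ f n s → total f (replicate n s) ≡ n * f s
total-replicate f zero    s = refl
total-replicate f (suc n) s = cong (λ t → f s + t) (total-replicate f n s)

moment-replicate-pos : ∀ c n → moment c (replicate n pos) + n ≡ n * (2 * c + n)
moment-replicate-pos c zero    = refl
moment-replicate-pos c (suc n) = begin
    2 * c + M + suc n                ≡⟨ regroup c n M ⟩
    2 * c + 1 + (M + n)              ≡⟨ cong (λ t → 2 * c + 1 + t) (moment-replicate-pos (suc c) n) ⟩
    2 * c + 1 + n * (2 * suc c + n)  ≡⟨ square c n ⟩
    suc n * (2 * c + suc n)          ∎
  where
  open ≡-Reasoning
  M = moment (suc c) (replicate n pos)
  regroup : ∀ c n M → 2 * c + M + suc n ≡ 2 * c + 1 + (M + n)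
  regroup = solve-∀
  square : ∀ c n → 2 * c + 1 + n * (2 * suc c + n) ≡ suc n * (2 * c + suc n)
  square = solve-∀

total-weight+absS : ∀ {n} (v : Vec Sign n) → total weight v + total absS v ≡ n + 2 * total isPos v
total-weight+absS []              = refl
total-weight+absS {suc n} (s ∷ v) = begin
    (weight s + total weight v) + (absS s + total absS v)
  ≡⟨ ℕ+.interchange (weight s) _ _ _ ⟩
    (weight s + absS s) + (total weight v + total absS v)
  ≡⟨ cong₂ _+_ (sign-count s) (total-weight+absS v) ⟩
    (1 + 2 * isPos s) + (n + 2 * total isPos v)
  ≡⟨ regroup (isPos s) n (total isPos v) ⟩
    suc n + 2 * (isPos s + total isPos v)
  ∎
  where
  open ≡-Reasoning
  regroup : ∀ x n P → (1 + 2 * x) + (n + 2 * P) ≡ suc n + 2 * (x + P)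
  regroup = solve-∀
  sign-count : ∀ s → weight s + absS s ≡ 1 + 2 * isPos s
  sign-count neg = refl
  sign-count zer = refl
  sign-count pos = refl

total-weight-odd : ∀ {h} (v : Vec Sign (suc h)) → total absS v ≡ h →
                   total weight v ≡ suc (2 * total isPos v)
total-weight-odd {h} v |v|≡h = ℕₚ.+-cancelʳ-≡ h _ _ (begin
    total weight v + h               ≡⟨ cong (λ t → total weight v + t) (sym |v|≡h) ⟩
    total weight v + total absS v    ≡⟨ total-weight+absS v ⟩
    suc h + 2 * total isPos v        ≡⟨ ℕₚ.+-comm (suc h) _ ⟩
    2 * total isPos v + suc h        ≡⟨ ℕₚ.+-suc _ h ⟩
    suc (2 * total isPos v) + h      ∎)
  where open ≡-Reasoning

total-isPos≤absS : ∀ {n} (v : Vec Sign n) → total isPos v ≤ total absS v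
total-isPos≤absS []        = z≤n
total-isPos≤absS (neg ∷ v) = ℕₚ.m≤n⇒m≤1+n (total-isPos≤absS v)
total-isPos≤absS (zer ∷ v) = total-isPos≤absS v
total-isPos≤absS (pos ∷ v) = s≤s (total-isPos≤absS v)

moment≤moment-replicate-pos : ∀ c {n} (v : Vec Sign n) → moment c v ≤ moment c (replicate n pos)
moment≤moment-replicate-pos c []      = z≤n
moment≤moment-replicate-pos c (s ∷ v) =
  ℕₚ.+-mono-≤ (ℕₚ.*-monoˡ-≤ c (weight≤2 s)) (moment≤moment-replicate-pos (suc c) v)
  where
  weight≤2 : ∀ s → weight s ≤ 2
  weight≤2 neg = z≤n
  weight≤2 zer = s≤s z≤n
  weight≤2 pos = ℕₚ.≤-refl

isPos+moment< : ∀ {h} (v : Vec Sign (suc h)) → total absS v ≡ h →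
                total isPos v + moment 0 v < suc h * suc h
isPos+moment< {h} v |v|≡h = begin-strict
    total isPos v + moment 0 v  ≤⟨ ℕₚ.+-monoˡ-≤ (moment 0 v) isPos≤h ⟩
    h + moment 0 v              <⟨ ℕₚ.+-monoʳ-< h (s≤s (moment≤moment-replicate-pos 0 v)) ⟩
    h + suc M                   ≡⟨ ℕₚ.+-suc h M ⟩
    suc h + M                   ≡⟨ ℕₚ.+-comm (suc h) M ⟩
    M + suc h                   ≡⟨ moment-replicate-pos 0 (suc h) ⟩
    suc h * suc h               ∎
  where
  open ℕₚ.≤-Reasoning
  M = moment 0 (replicate (suc h) pos)
  isPos≤h = subst (total isPos v ≤_) |v|≡h (total-isPos≤absS v)

signs : List Sign
signs = neg ∷ zer ∷ pos ∷ []

∈-signs : ∀ s → s ∈ signs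
∈-signs neg = here refl
∈-signs zer = there (here refl)
∈-signs pos = there (there (here refl))

allVecs : ∀ n → List (Vec Sign n)
allVecs zero    = [ [] ]
allVecs (suc n) = cartesianProductWith _∷_ signs (allVecs n)

∈-allVecs : ∀ {n} (v : Vec Sign n) → v ∈ allVecs n
∈-allVecs []      = here refl
∈-allVecs (s ∷ v) = ∈-cartesianProductWith⁺ _∷_ (∈-signs s) (∈-allVecs v)

-- h + 1 coefficients: p of them +1, one 0, the rest −1, with moment m
Realisable : ℕ → ℕ → ℕ → Set
Realisable h p m =
  Σ (Vec Sign (suc h)) λ v → total absS v ≡ h × total weight v ≡ suc (2 * p) × moment 0 v ≡ m

realisable? : ∀ h p m → Dec (Realisable h p m)
realisable? h p m =
  map′ satisfied (λ (v , v✓) → lose (∈-allVecs v) v✓) (any? realises? (allVecs (suc h)))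
  where
  realises? = λ v → (total absS v ≟ h) ×-dec (total weight v ≟ suc (2 * p)) ×-dec (moment 0 v ≟ m)

realisable-∷ʳ-neg : ∀ {h p m} → Realisable h p m → Realisable (suc h) p m
realisable-∷ʳ-neg {h} (v , |v|≡h , v-weight , v-moment) = v ∷ʳ neg ,
  trans (total-∷ʳ absS v neg) (trans (cong (_+ 1) |v|≡h) (ℕₚ.+-comm h 1)) ,
  trans (total-∷ʳ weight v neg) (trans (ℕₚ.+-identityʳ _) v-weight) ,
  trans (moment-∷ʳ 0 v neg) (trans (ℕₚ.+-identityʳ _) v-moment)

realisable-∷ʳ-pos : ∀ {h p m} → Realisable h p m → Realisable (suc h) (suc p) (m + 2 * suc h)
realisable-∷ʳ-pos {h} {p} (v , |v|≡h , v-weight , v-moment) = v ∷ʳ pos ,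
  trans (total-∷ʳ absS v pos) (trans (cong (_+ 1) |v|≡h) (ℕₚ.+-comm h 1)) ,
  trans (total-∷ʳ weight v pos) (trans (cong (_+ 2) v-weight) (odd-+2 p)) ,
  trans (moment-∷ʳ 0 v pos) (cong (_+ 2 * suc h) v-moment)
  where
  odd-+2 : ∀ p → suc (2 * p) + 2 ≡ suc (2 * suc p)
  odd-+2 = solve-∀

realisable-square : ∀ n → Realisable n n (n * n)
realisable-square n = pos* ∷ʳ zer ,
  trans (total-∷ʳ absS pos* zer)
    (trans (ℕₚ.+-identityʳ _) (trans (total-replicate absS n pos) (ℕₚ.*-identityʳ n))) ,
  trans (total-∷ʳ weight pos* zer)
    (trans (cong (_+ 1) (trans (total-replicate weight n pos) (ℕₚ.*-comm n 2))) (ℕₚ.+-comm (2 * n) 1)) ,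
  trans (moment-∷ʳ 0 pos* zer)
    (trans (cong (λ t → moment 0 pos* + t) (ℕₚ.+-identityʳ n)) (moment-replicate-pos 0 n))
  where pos* = replicate n pos

-- Key h p r: the pair (p, p² + r) is one of the (h + 1)² pairs realised for h ≥ 3.
Key : ℕ → ℕ → ℕ → Set
Key h p r = (p < h × r ≤ 2 * p + 1) ⊎ (p ≡ h × r ≤ h)

key? : ∀ h p r → Dec (Key h p r)
key? h p r = ((p <? h) ×-dec (r ≤? 2 * p + 1)) ⊎-dec ((p ≟ h) ×-dec (r ≤? h))

key-bounded : ∀ {h p r} → Key h p r → p ≤ h × r ≤ 2 * h + 1
key-bounded {h} {p} (inj₁ (p<h , r≤2p+1)) =
  ℕₚ.<⇒≤ p<h , ℕₚ.≤-trans r≤2p+1 (ℕₚ.+-monoˡ-≤ 1 (ℕₚ.*-monoʳ-≤ 2 (ℕₚ.<⇒≤ p<h)))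
key-bounded {h} (inj₂ (refl , r≤h)) =
  ℕₚ.≤-refl , ℕₚ.≤-trans r≤h (ℕₚ.≤-trans (ℕₚ.m≤m+n h _) (ℕₚ.m≤m+n (2 * h) 1))

realisable-keys-3 : ∀ {p r} → Key 3 p r → Realisable 3 p (p * p + r)
realisable-keys-3 k = let p≤3 , r≤7 = key-bounded k in table (s≤s p≤3) (s≤s r≤7) k
  where
  -- exhaustive search through all 3⁴ sign vectors
  table : ∀ {p} → p < 4 → ∀ {r} → r < 8 → Key 3 p r → Realisable 3 p (p * p + r)
  table = from-yes
    (ℕₚ.allUpTo? (λ p → ℕₚ.allUpTo? (λ r → key? 3 p r →-dec realisable? 3 p (p * p + r)) 8) 4)

realisable-keys-step : ∀ g → (∀ {p r} → Key (2 + g) p r → Realisable (2 + g) p (p * p + r))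
                           → ∀ {p r} → Key (3 + g) p r → Realisable (3 + g) p (p * p + r)
realisable-keys-step g IH {p} {r} (inj₁ (p<3+g , r≤2p+1)) with p <? 2 + g
... | yes p<2+g = realisable-∷ʳ-neg {p = p} (IH (inj₁ (p<2+g , r≤2p+1)))
... | no p≮2+g with ℕₚ.≤-antisym (s≤s⁻¹ p<3+g) (ℕₚ.≮⇒≥ p≮2+g)
...   | refl with r ≤? 2 + g
...     | yes r≤2+g = realisable-∷ʳ-neg {p = 2 + g} (IH (inj₂ (refl , r≤2+g)))
...     | no r≰2+g with ℕₚ.m≤n⇒∃[o]m+o≡n (ℕₚ.≰⇒> r≰2+g)
...       | t , refl = subst (Realisable (3 + g) (2 + g)) (shifted-square g t)
                         (realisable-∷ʳ-pos {p = 1 + g} (IH (inj₁ (ℕₚ.≤-refl , t-bound))))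
  where
  shifted-square : ∀ g t →
    (1 + g) * (1 + g) + (g + t) + 2 * (3 + g) ≡ (2 + g) * (2 + g) + (3 + g + t)
  shifted-square = solve-∀
  bound-shape : ∀ g → 2 * (2 + g) + 1 ≡ 3 + 2 * suc g
  bound-shape = solve-∀
  t-bound : g + t ≤ 2 * suc g + 1
  t-bound = ℕₚ.m≤n⇒m≤n+o 1
    (ℕₚ.+-cancelˡ-≤ 3 (g + t) _ (subst (3 + g + t ≤_) (bound-shape g) r≤2p+1))
realisable-keys-step g IH {r = zero} (inj₂ (refl , _)) =
  subst (Realisable (3 + g) (3 + g)) (sym (ℕₚ.+-identityʳ _)) (realisable-square (3 + g))
realisable-keys-step g IH {r = suc r} (inj₂ (refl , s≤s r≤2+g)) =
  subst (Realisable (3 + g) (3 + g)) (shifted-square g r)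
    (realisable-∷ʳ-pos {p = 2 + g} (IH (inj₂ (refl , r≤2+g))))
  where
  shifted-square : ∀ g r → (2 + g) * (2 + g) + r + 2 * (3 + g) ≡ (3 + g) * (3 + g) + suc r
  shifted-square = solve-∀

realisable-keys : ∀ k {p r} → Key (3 + k) p r → Realisable (3 + k) p (p * p + r)
realisable-keys zero    = realisable-keys-3
realisable-keys (suc k) = realisable-keys-step (suc k) (realisable-keys k)

-- (h − 1, h² + 1) lies just past the end of block h − 1
realisable-overshoot : ∀ k → Realisable (3 + k) (2 + k) (suc ((3 + k) * (3 + k)))
realisable-overshoot zero    = (neg ∷ pos ∷ zer ∷ pos ∷ []) , refl , refl , refl
realisable-overshoot (suc k) = subst (Realisable (4 + k) (3 + k)) (shifted-square k)
  (realisable-∷ʳ-pos {p = 2 + k} (realisable-keys k (inj₁ (ℕₚ.≤-refl , ℕₚ.≤-refl))))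
  where
  shifted-square : ∀ k →
    (2 + k) * (2 + k) + (2 * (2 + k) + 1) + 2 * (4 + k) ≡ suc ((4 + k) * (4 + k))
  shifted-square = solve-∀

-- key i runs through the pairs (p, r) with r ≤ 2p + 1 in lexicographic order;
-- (p, r) comes at position p² + p + r.
next : ℕ × ℕ → ℕ × ℕ
next (p , r) with r <? 2 * p + 1
... | yes _ = p , suc r
... | no  _ = suc p , 0

key : ℕ → ℕ × ℕ
key zero    = 0 , 0
key (suc i) = next (key i)

KeyOf : ℕ → ℕ × ℕ → Set
KeyOf i (p , r) = r ≤ 2 * p + 1 × p * p + p + r ≡ i

next-keyOf : ∀ {i} q → KeyOf i q → KeyOf (suc i) (next q)
next-keyOf (p , r) (r≤2p+1 , pos≡i) with r <? 2 * p + 1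
... | yes r<2p+1 = r<2p+1 , trans (ℕₚ.+-suc (p * p + p) r) (cong suc pos≡i)
... | no r≮2p+1 with ℕₚ.≤-antisym r≤2p+1 (ℕₚ.≮⇒≥ r≮2p+1)
...   | refl = z≤n , trans (next-block p) (cong suc pos≡i)
  where
  next-block : ∀ p → suc p * suc p + suc p + 0 ≡ suc (p * p + p + (2 * p + 1))
  next-block = solve-∀

keyOf-key : ∀ i → KeyOf i (key i)
keyOf-key zero    = z≤n , refl
keyOf-key (suc i) = next-keyOf (key i) (keyOf-key i)

keyOf⇒Key : ∀ {h i p r} → KeyOf i (p , r) → i < suc h * suc h → Key h p r
keyOf⇒Key {h} {i} {p} {r} (r≤2p+1 , pos≡i) i<N with p <? h
... | yes p<h = inj₁ (p<h , r≤2p+1)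
... | no p≮h with ℕₚ.m≤n⇒m<n∨m≡n (ℕₚ.≮⇒≥ p≮h)
...   | inj₁ h<p = contradiction i<N (ℕₚ.≤⇒≯ (begin
          suc h * suc h     ≤⟨ ℕₚ.*-mono-≤ h<p h<p ⟩
          p * p             ≤⟨ ℕₚ.≤-trans (ℕₚ.m≤m+n (p * p) p) (ℕₚ.m≤m+n (p * p + p) r) ⟩
          p * p + p + r     ≡⟨ pos≡i ⟩
          i                 ∎))
  where open ℕₚ.≤-Reasoning
...   | inj₂ refl = inj₂ (refl , s≤s⁻¹ (ℕₚ.+-cancelˡ-< (h * h + h) r (suc h)
          (subst₂ _<_ (sym pos≡i) (square-split h) i<N)))
  where
  square-split : ∀ h → suc h * suc h ≡ h * h + h + suc h
  square-split = solve-∀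

key-Key : ∀ {h i} → i < suc h * suc h → Key h (proj₁ (key i)) (proj₂ (key i))
key-Key {i = i} = keyOf⇒Key (keyOf-key i)

module Chain (a d : ℕ) (a≥1 : 1 ≤ a) (d≥1 : 1 ≤ d) where

  W : ℕ → ℕ → ℕ
  W p m = a * suc (2 * p) + d * m

  W-suc : ∀ p m → W (suc p) m ≡ W p m + 2 * a
  W-suc p m = expand a d p m
    where
    expand : ∀ a d p m → a * suc (2 * suc p) + d * m ≡ a * suc (2 * p) + d * m + 2 * a
    expand = solve-∀

  W-sucʳ : ∀ p m → W p (suc m) ≡ W p m + d
  W-sucʳ p m = expand a d p m
    where
    expand : ∀ a d p m → a * suc (2 * p) + d * suc m ≡ a * suc (2 * p) + d * m + d
    expand = solve-∀

  W<W-suc : ∀ p m → W p m < W (suc p) m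
  W<W-suc p m =
    subst (W p m <_) (sym (W-suc p m)) (ℕₚ.m<m+n (W p m) (ℕₚ.≤-trans a≥1 (ℕₚ.m≤m+n a _)))

  W<W-sucʳ : ∀ p m → W p m < W p (suc m)
  W<W-sucʳ p m = subst (W p m <_) (sym (W-sucʳ p m)) (ℕₚ.m<m+n (W p m) d≥1)

  W-mono-≤ : ∀ {p p′ m m′} → p ≤ p′ → m ≤ m′ → W p m ≤ W p′ m′
  W-mono-≤ p≤p′ m≤m′ =
    ℕₚ.+-mono-≤ (ℕₚ.*-monoʳ-≤ a (s≤s (ℕₚ.*-monoʳ-≤ 2 p≤p′))) (ℕₚ.*-monoʳ-≤ d m≤m′)

  keyValue : ℕ × ℕ → ℕ
  keyValue (p , r) = W p (p * p + r)

  keyValue<keyValue-next : ∀ q → proj₂ q ≤ 2 * proj₁ q + 1 → keyValue q < keyValue (next q)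
  keyValue<keyValue-next (p , r) r≤2p+1 with r <? 2 * p + 1
  ... | yes _ =
    subst (λ m → W p (p * p + r) < W p m) (sym (ℕₚ.+-suc (p * p) r)) (W<W-sucʳ p (p * p + r))
  ... | no r≮2p+1 with ℕₚ.≤-antisym r≤2p+1 (ℕₚ.≮⇒≥ r≮2p+1)
  ...   | refl =
    subst (λ m → keyValue (p , r) < W (suc p) m) (next-square p) (W<W-suc p (p * p + r))
    where
    next-square : ∀ p → p * p + (2 * p + 1) ≡ suc p * suc p + 0
    next-square = solve-∀

  chainValue : ℕ → ℕ
  chainValue i = keyValue (key i)

  chainValue<chainValue-suc : ∀ i → chainValue i < chainValue (suc i)
  chainValue<chainValue-suc i = keyValue<keyValue-next (key i) (proj₁ (keyOf-key i))

  chainValue-increasing : ∀ {i j} → i < j → chainValue i < chainValue j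
  chainValue-increasing {i} {suc j} (s≤s i≤j) with ℕₚ.m≤n⇒m<n∨m≡n i≤j
  ... | inj₁ i<j  = ℕₚ.<-trans (chainValue-increasing i<j) (chainValue<chainValue-suc j)
  ... | inj₂ refl = chainValue<chainValue-suc i

  keyValue≢overshoot : ∀ {g p r} → d ≢ 2 * a → Key (suc g) p r →
                       W p (p * p + r) ≢ W g (suc (suc g * suc g))
  keyValue≢overshoot {g} {p} {r} _ (inj₁ (p<1+g , r≤2p+1)) = ℕₚ.<⇒≢ (begin-strict
      W p (p * p + r)
        ≤⟨ W-mono-≤ (s≤s⁻¹ p<1+g) (ℕₚ.≤-trans (ℕₚ.+-monoʳ-≤ (p * p) r≤2p+1) m≤G) ⟩
      W g (suc g * suc g)          <⟨ W<W-sucʳ g _ ⟩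
      W g (suc (suc g * suc g))    ∎)
    where
    open ℕₚ.≤-Reasoning
    square : ∀ p → p * p + (2 * p + 1) ≡ suc p * suc p
    square = solve-∀
    m≤G : p * p + (2 * p + 1) ≤ suc g * suc g
    m≤G = subst (_≤ suc g * suc g) (sym (square p)) (ℕₚ.*-mono-≤ p<1+g p<1+g)
  keyValue≢overshoot {g} {r = zero} d≢2a (inj₂ (refl , _)) eq =
    d≢2a (sym (ℕₚ.+-cancelˡ-≡ (W g G) _ _ (begin
      W g G + 2 * a         ≡⟨ sym (W-suc g G) ⟩
      W (suc g) G           ≡⟨ cong (W (suc g)) (sym (ℕₚ.+-identityʳ G)) ⟩
      W (suc g) (G + 0)     ≡⟨ eq ⟩
      W g (suc G)           ≡⟨ W-sucʳ g G ⟩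
      W g G + d             ∎)))
    where
    open ≡-Reasoning
    G = suc g * suc g
  keyValue≢overshoot {g} {r = suc r} _ (inj₂ (refl , _)) = ℕₚ.>⇒≢ (begin-strict
      W g (suc G)           <⟨ W<W-suc g (suc G) ⟩
      W (suc g) (suc G)
        ≤⟨ W-mono-≤ (ℕₚ.≤-refl {suc g}) (subst (suc G ≤_) (sym (ℕₚ.+-suc G r)) (s≤s (ℕₚ.m≤m+n G r))) ⟩
      W (suc g) (G + suc r) ∎)
    where
    open ℕₚ.≤-Reasoning
    G = suc g * suc g

module SignedSumset (h a d : ℕ) where

  signedSum : Vec Sign (suc h) → ℤ
  signedSum v = sumℤ (λ i → val (lookup v i) ℤ.* AP a d h i)

  Attained : ℤ → Set
  Attained x = Σ (Vec Sign (suc h)) λ v → total absS v ≡ h × signedSum v ≡ x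

  attained⇔ : ∀ x → Attained x ⇔ InSignedSumset h (suc h) (AP a d h) x
  attained⇔ x = mk⇔
    (λ (v , |v|≡h , v↦x) → lookup v , trans (sumℕ-lookup absS v) |v|≡h , v↦x)
    (λ (σ , |σ|≡h , σ↦x) → tabulate σ ,
       trans (sym (sumℕ-lookup absS (tabulate σ)))
         (trans (sumℕ-cong (cong absS ∘ lookup∘tabulate σ)) |σ|≡h) ,
       trans (sumℤ-cong (λ i → cong (λ s → val s ℤ.* AP a d h i) (lookup∘tabulate σ i))) σ↦x)

  absSum≟h : (v : Vec Sign (suc h)) → Dec (total absS v ≡ h)
  absSum≟h v = total absS v ≟ h

  elements : List ℤ
  elements = deduplicate ℤ._≟_ (map signedSum (filter absSum≟h (allVecs (suc h))))

  ∈-elements⇔ : ∀ x → x ∈ elements ⇔ Attained x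
  ∈-elements⇔ x = mk⇔
    (λ x∈ → let v , _ , x≡ , |v|≡h = ∈-map∘filter⁻ signedSum absSum≟h {xs = allVecs (suc h)}
                                        (∈-deduplicate⁻ ℤ._≟_ _ x∈)
            in v , |v|≡h , sym x≡)
    (λ (v , |v|≡h , v↦x) → ∈-deduplicate⁺ ℤ._≟_
       (∈-map∘filter⁺ signedSum absSum≟h {xs = allVecs (suc h)} (v , ∈-allVecs v , sym v↦x , |v|≡h)))

  signedSumset-card : HasCard (InSignedSumset h (suc h) (AP a d h)) (length elements)
  signedSumset-card = elements , deduplicate-! _ , refl , λ x → ⇔.trans (∈-elements⇔ x) (attained⇔ x)

  offset : ℕ
  offset = sumℕ (λ (i : Fin (suc h)) → a + toℕ i * d)

  shift : ℤ → ℤ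
  shift x = x ℤ.+ + offset

  shift-signedSum : ∀ v → shift (signedSum v) ≡ + (a * total weight v + d * moment 0 v)
  shift-signedSum v =
    trans (signedSum+sum (lookup v) (λ i → a + toℕ i * d)) (cong +_ (weightedSum-AP a d v 0))

  shifted : List ℤ
  shifted = map shift elements

  shifted-unique : Unique shifted
  shifted-unique = Uniqueₚ.map⁺ (∙-cancelʳ _ _ _) (deduplicate-! _)

  length-shifted : length shifted ≡ length elements
  length-shifted = Listₚ.length-map shift elements

  realisable⇒∈shifted : ∀ {p m} → Realisable h p m → + (a * suc (2 * p) + d * m) ∈ shifted
  realisable⇒∈shifted (v , |v|≡h , v-weight , v-moment) =
    subst (_∈ shifted)
      (trans (shift-signedSum v) (cong +_ (cong₂ (λ w m → a * w + d * m) v-weight v-moment)))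
      (∈-map⁺ shift (Equivalence.from (∈-elements⇔ _) (v , |v|≡h , refl)))

  shift-signedSum-odd : d ≡ 2 * a → ∀ v → total absS v ≡ h →
                        shift (signedSum v) ≡ + (a * suc (2 * (total isPos v + moment 0 v)))
  shift-signedSum-odd d≡2a v |v|≡h = trans (shift-signedSum v) (cong +_ (begin
      a * total weight v + d * M       ≡⟨ cong₂ (λ w e → a * w + e * M) (total-weight-odd v |v|≡h) d≡2a ⟩
      a * suc (2 * P) + 2 * a * M      ≡⟨ odd-multiple a P M ⟩
      a * suc (2 * (P + M))            ∎))
    where
    open ≡-Reasoning
    P = total isPos v
    M = moment 0 v
    odd-multiple : ∀ a P M → a * suc (2 * P) + 2 * a * M ≡ a * suc (2 * (P + M))
    odd-multiple = solve-∀

  oddMultiple : ℕ → ℤ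
  oddMultiple t = + (a * suc (2 * t))

  oddMultiples : List ℤ
  oddMultiples = applyUpTo oddMultiple (suc h * suc h)

  shifted⊆oddMultiples : d ≡ 2 * a → shifted ⊆ oddMultiples
  shifted⊆oddMultiples d≡2a y∈shifted with ∈-map⁻ shift y∈shifted
  ... | x , x∈elements , refl with Equivalence.to (∈-elements⇔ x) x∈elements
  ... | v , |v|≡h , refl = subst (_∈ oddMultiples) (sym (shift-signedSum-odd d≡2a v |v|≡h))
                             (∈-applyUpTo⁺ oddMultiple (isPos+moment< v |v|≡h))

  upper-bound : d ≡ 2 * a → length elements ≤ suc h * suc h
  upper-bound d≡2a = begin
    length elements     ≡⟨ sym length-shifted ⟩
    length shifted      ≤⟨ unique-⊆⇒length≤ shifted-unique (shifted⊆oddMultiples d≡2a) ⟩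
    length oddMultiples ≡⟨ Listₚ.length-applyUpTo oddMultiple (suc h * suc h) ⟩
    suc h * suc h       ∎
    where open ℕₚ.≤-Reasoning

module LowerBounds (k a d : ℕ) (a≥1 : 1 ≤ a) (d≥1 : 1 ≤ d) where
  open SignedSumset (3 + k) a d
  open Chain a d a≥1 d≥1

  N : ℕ
  N = (4 + k) * (4 + k)

  chain : List ℤ
  chain = applyUpTo (+_ ∘ chainValue) N

  chain-unique : Unique chain
  chain-unique = Uniqueₚ.applyUpTo⁺₁ (+_ ∘ chainValue) N
    (λ i<j _ → ℕₚ.<⇒≢ (chainValue-increasing i<j) ∘ ℤₚ.+-injective)

  chainValue∈shifted : ∀ {i} → i < N → + chainValue i ∈ shifted
  chainValue∈shifted {i} i<N = realisable⇒∈shifted {p = p} (realisable-keys k {p} {r} (key-Key i<N))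
    where
    p = proj₁ (key i)
    r = proj₂ (key i)

  chain⊆shifted : chain ⊆ shifted
  chain⊆shifted y∈chain with ∈-applyUpTo⁻ (+_ ∘ chainValue) y∈chain
  ... | i , i<N , refl = chainValue∈shifted i<N

  overshoot : ℕ
  overshoot = W (2 + k) (suc ((3 + k) * (3 + k)))

  overshoot∉chain : d ≢ 2 * a → All (+ overshoot ≢_) chain
  overshoot∉chain d≢2a = Allₚ.applyUpTo⁺₁ (+_ ∘ chainValue) N λ {i} i<N overshoot≡ →
    keyValue≢overshoot {g = 2 + k} d≢2a (key-Key {i = i} i<N) (sym (ℤₚ.+-injective overshoot≡))

  overshoot∷chain⊆shifted : (+ overshoot ∷ chain) ⊆ shifted
  overshoot∷chain⊆shifted (here refl)     = realisable⇒∈shifted {p = 2 + k} (realisable-overshoot k)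
  overshoot∷chain⊆shifted (there y∈chain) = chain⊆shifted y∈chain

  lower-bound : N ≤ length elements
  lower-bound = begin
    N               ≡⟨ sym (Listₚ.length-applyUpTo (+_ ∘ chainValue) N) ⟩
    length chain    ≤⟨ unique-⊆⇒length≤ chain-unique chain⊆shifted ⟩
    length shifted  ≡⟨ length-shifted ⟩
    length elements ∎
    where open ℕₚ.≤-Reasoning

  lower-bound-strict : d ≢ 2 * a → N < length elements
  lower-bound-strict d≢2a = begin-strict
    N                            ≡⟨ sym (Listₚ.length-applyUpTo (+_ ∘ chainValue) N) ⟩
    length chain                 <⟨ ℕₚ.≤-refl ⟩
    length (+ overshoot ∷ chain)
      ≤⟨ unique-⊆⇒length≤ (overshoot∉chain d≢2a ∷ chain-unique) overshoot∷chain⊆shifted ⟩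
    length shifted               ≡⟨ length-shifted ⟩
    length elements              ∎
    where open ℕₚ.≤-Reasoning

theorem2p4 : (h a d : ℕ) → h ≥ 3 → 1 ≤ a → 1 ≤ d →
    Σ ℕ λ n → HasCard (InSignedSumset h (suc h) (AP a d h)) n
      × (d ≡ 2 * a → (suc h) * (suc h) ≤ n)
      × (¬ (d ≡ 2 * a) → (suc h) * (suc h) + 1 ≤ n)
      × ((n ≡ (suc h) * (suc h)) ⇔ (d ≡ 2 * a))
theorem2p4 h@(suc (suc (suc k))) a d (s≤s (s≤s (s≤s _))) a≥1 d≥1 =
  length elements ,
  signedSumset-card ,
  (λ _ → lower-bound) ,
  subst (_≤ length elements) (ℕₚ.+-comm 1 N) ∘ lower-bound-strict ,
  mk⇔ (λ n≡N → decidable-stable (d ≟ 2 * a) (ℕₚ.<-irrefl (sym n≡N) ∘ lower-bound-strict))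
      (λ d≡2a → ℕₚ.≤-antisym (upper-bound d≡2a) lower-bound)
  where
  open SignedSumset h a d
  open LowerBounds k a d a≥1 d≥1
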